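{- For every integer $k\geq 2$ there exists an infinite family of $(k-1)$-diregular directed graphs (every vertex has in-degree and out-degree equal to $k-1$) each of which is $k$-ordered hamiltonian.
   Context: Directed graphs are finite, without loops or multiple arcs. A directed graph $D$ is $r$-ordered hamiltonian if, for every sequence $v_1, \ldots, v_r$ of $r$ distinct vertices of $D$, there exists a directed hamiltonian cycle in $D$ (a directed cycle through all vertices) containing $v_1, \ldots, v_r$ in this (cyclic) order. -}

module Defs where

open import Data.Nat using (ℕ; zero; suc; _<_)
open import Data.Fin using (Fin; zero; suc; inject₁; fromℕ)
open import Data.Fin.Base using () renaming (_<_ to _<ᶠ_)
open import Data.Bool using (Bool; true; false; T)
open import Data.List using (length; filterᵇ)
open import Data.List using () renaming (allFin to allFinL)
open import Data.Product using (Σ; _×_)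
open import Function.Definitions using (Injective)
open import Relation.Binary.PropositionalEquality using (_≡_)

-- A finite digraph on vertex set Fin n: Boolean arc relation, no loops.
-- (No multiple arcs is automatic: the arc relation is a relation.)
record Digraph (n : ℕ) : Set where
  field
    arc     : Fin n → Fin n → Bool
    noLoops : ∀ v → arc v v ≡ false
open Digraph public

Arc : ∀ {n} → Digraph n → Fin n → Fin n → Set
Arc D u v = T (arc D u v)

outDeg : ∀ {n} → Digraph n → Fin n → ℕ
outDeg {n} D u = length (filterᵇ (λ v → arc D u v) (allFinL n))

inDeg : ∀ {n} → Digraph n → Fin n → ℕ
inDeg {n} D v = length (filterᵇ (λ u → arc D u v) (allFinL n))

Diregular : ∀ {n} → ℕ → Digraph n → Set
Diregular d D = ∀ v → (outDeg D v ≡ d) × (inDeg D v ≡ d)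

record HamCycle {m : ℕ} (D : Digraph (suc m)) : Set where
  field
    cyc      : Fin (suc m) → Fin (suc m)
    cycInj   : Injective _≡_ _≡_ cyc
    cycArcs  : ∀ (i : Fin m) → Arc D (cyc (inject₁ i)) (cyc (suc i))
    cycClose : Arc D (cyc (fromℕ m)) (cyc zero)
open HamCycle public

-- The hamiltonian cycle C contains v 0, …, v (r-1) in this cyclic order:
-- reading C starting from v 0, the vertices appear at strictly
-- increasing positions.
ContainsInOrder : ∀ {m r} {D : Digraph (suc m)} →
                  HamCycle D → (Fin (suc r) → Fin (suc m)) → Set
ContainsInOrder {m} {r} C v =
  (cyc C zero ≡ v zero) ×
  Σ (Fin (suc r) → Fin (suc m)) λ p →
    (∀ i → cyc C (p i) ≡ v i) × (∀ i j → i <ᶠ j → p i <ᶠ p j)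

OrderedHamiltonian : ∀ {m} → ℕ → Digraph (suc m) → Set
OrderedHamiltonian zero    D = HamCycle D
OrderedHamiltonian (suc r) D =
  ∀ (v : Fin (suc r) → _) → Injective _≡_ _≡_ v →
    Σ (HamCycle D) λ C → ContainsInOrder C v

{-# OPTIONS --safe #-}
module Submission where

-- The digraph is the blow-up of the directed m-cycle in which every vertex becomes an
-- independent layer of a = k − 1 vertices, each pointing to all of the next layer; it is
-- a-diregular. A hamiltonian cycle is any listing of the vertices whose layer advances
-- by one at each step. Given distinct v₀, …, v_a, put v₀ at position 0 and each v_{i+1}
-- at the first later position in its layer. These positions fit into the a·m slots
-- because the a + 1 vertices cannot all lie in one layer of size a. Starting from the
-- rotation that puts v₀'s layer at position 0, transpositions inside layers then move
-- every v_i to its position.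

open import Data.Bool using (Bool; true; false; if_then_else_)
open import Data.Fin using (Fin; zero; suc; toℕ; fromℕ; fromℕ<)
  renaming (_<_ to _<ᶠ_; _≤_ to _≤ᶠ_)
open import Data.Fin.Permutation.Components using (transpose; transpose-inverse)
open import Data.Fin.Properties
  using (suc-injective; 0≢1+n; toℕ-fromℕ; toℕ-fromℕ<; toℕ-inject₁; toℕ-injective; toℕ<n; injective⇒≤; ≤fromℕ)
  renaming (_≟_ to _≟ᶠ_)
import Data.Fin.Properties as Finₚ
open import Data.List using (length; filterᵇ; tabulate; allFin)
open import Data.Nat using (ℕ; zero; suc; _+_; _*_; _∸_; _≤_; _<_; _≡ᵇ_; _<?_; _≟_; s≤s; z≤n; NonZero)
open import Data.Nat.Divisibility using (divides)
open import Data.Nat.DivMod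
  using (_%_; _/_; _mod_; m%n<n; m<n⇒m%n≡m; n%n≡0; m%n%n≡m%n; [m+n]%n≡m%n; [m+kn]%n≡m%n;
         %-distribˡ-+; m≡m%n+[m/n]*n; m<n*o⇒m/o<n; m∣n⇒o%n%m≡o%m)
open import Data.Nat.Properties
  using (+-assoc; +-comm; +-identityʳ; +-suc; *-identityʳ; ≤-reflexive; ≤-trans; <⇒≤; ≤-<-trans; <-≤-trans;
         <-irrefl; ≮⇒≥; ≤∧≢⇒<; m≤n⇒m<n∨m≡n; 1+n≢n; ≡⇒≡ᵇ; m≤m+n; m≤n+m; +-mono-≤; +-monoʳ-≤; +-monoʳ-<;
         +-mono-≤-<; +-mono-<-≤; m∸n≤m; m+n∸n≡m; m+[n∸m]≡n; m<n⇒0<n∸m; ∸-monoʳ-≤; ∸-monoʳ-<)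
open import Data.Product using (Σ; ∃-syntax; _×_; _,_)
open import Data.Sum using (_⊎_; inj₁; inj₂)
open import Function using (_∘_; id)
open import Function.Definitions using (Injective)
open import Relation.Binary.Definitions using (tri<; tri≈; tri>)
open import Relation.Binary.PropositionalEquality
open import Relation.Nullary using (¬_; yes; no; contradiction)
open import Relation.Nullary.Decidable using (dec-false)

open import Defs

indicator : Bool → ℕ
indicator b = if b then 1 else 0

count : ℕ → (ℕ → Bool) → ℕ
count zero    g = 0
count (suc n) g = indicator (g 0) + count n (g ∘ suc)

length-filterᵇ-tabulate : ∀ {A : Set} {n} (p : A → Bool) (f : Fin n → A) (g : ℕ → Bool) →
                          (∀ i → p (f i) ≡ g (toℕ i)) →
                          length (filterᵇ p (tabulate f)) ≡ count n g
length-filterᵇ-tabulate {n = zero}  p f g p∘f≗g = refl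
length-filterᵇ-tabulate {n = suc n} p f g p∘f≗g rewrite p∘f≗g zero with g 0
... | true  = cong suc (length-filterᵇ-tabulate p (f ∘ suc) (g ∘ suc) (p∘f≗g ∘ suc))
... | false = length-filterᵇ-tabulate p (f ∘ suc) (g ∘ suc) (p∘f≗g ∘ suc)

length-filterᵇ-allFin : ∀ n (g : ℕ → Bool) → length (filterᵇ (g ∘ toℕ) (allFin n)) ≡ count n g
length-filterᵇ-allFin n g = length-filterᵇ-tabulate {n = n} (g ∘ toℕ) id g (λ _ → refl)

count-cong : ∀ n {g h : ℕ → Bool} → (∀ x → x < n → g x ≡ h x) → count n g ≡ count n h
count-cong zero    g≗h = refl
count-cong (suc n) g≗h =
  cong₂ _+_ (cong indicator (g≗h 0 (s≤s z≤n)))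
            (count-cong n (λ x x<n → g≗h (suc x) (s≤s x<n)))

count-+ : ∀ m n g → count (m + n) g ≡ count m g + count n (g ∘ (m +_))
count-+ zero    n g = refl
count-+ (suc m) n g = trans (cong (indicator (g 0) +_) (count-+ m n (g ∘ suc)))
                            (sym (+-assoc (indicator (g 0)) _ _))

count-periodic : ∀ a m g → (∀ x → g (m + x) ≡ g x) → count (a * m) g ≡ a * count m g
count-periodic zero    m g periodic = refl
count-periodic (suc a) m g periodic = begin
  count (m + a * m) g                    ≡⟨ count-+ m (a * m) g ⟩
  count m g + count (a * m) (g ∘ (m +_)) ≡⟨ cong (count m g +_) (count-cong (a * m) (λ x _ → periodic x)) ⟩
  count m g + count (a * m) g            ≡⟨ cong (count m g +_) (count-periodic a m g periodic) ⟩
  count m g + a * count m g              ∎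
  where open ≡-Reasoning

count-last : ∀ n g → count (suc n) g ≡ count n g + indicator (g n)
count-last zero    g = +-comm (indicator (g 0)) 0
count-last (suc n) g = trans (cong (indicator (g 0) +_) (count-last n (g ∘ suc)))
                             (sym (+-assoc (indicator (g 0)) _ _))

count-false : ∀ n → count n (λ _ → false) ≡ 0
count-false zero    = refl
count-false (suc n) = count-false n

≡ᵇ-comm : ∀ x y → (x ≡ᵇ y) ≡ (y ≡ᵇ x)
≡ᵇ-comm zero    zero    = refl
≡ᵇ-comm zero    (suc y) = refl
≡ᵇ-comm (suc x) zero    = refl
≡ᵇ-comm (suc x) (suc y) = ≡ᵇ-comm x y

count-≡ᵇ : ∀ {n} c → c < n → count n (c ≡ᵇ_) ≡ 1
count-≡ᵇ {suc n} zero    _         = cong suc (count-false n)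
count-≡ᵇ {suc n} (suc c) (s≤s c<n) = count-≡ᵇ c c<n

count-rotate : ∀ n g → count (suc n) (λ x → g (suc x % suc n)) ≡ count (suc n) g
count-rotate n g = begin
  count (suc n) (g ∘ next)                    ≡⟨ count-last n (g ∘ next) ⟩
  count n (g ∘ next) + indicator (g (next n)) ≡⟨ cong₂ _+_ (count-cong n (λ x x<n → cong g (m<n⇒m%n≡m (s≤s x<n))))
                                                           (cong (indicator ∘ g) (n%n≡0 (suc n))) ⟩
  count n (g ∘ suc) + indicator (g 0)         ≡⟨ +-comm (count n (g ∘ suc)) (indicator (g 0)) ⟩
  count (suc n) g                             ∎
  where
  open ≡-Reasoning
  next : ℕ → ℕ
  next x = suc x % suc n

[m%d+n]%d≡[m+n]%d : ∀ m n d .{{_ : NonZero d}} → (m % d + n) % d ≡ (m + n) % d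
[m%d+n]%d≡[m+n]%d m n d = begin
  (m % d + n) % d          ≡⟨ %-distribˡ-+ (m % d) n d ⟩
  (m % d % d + n % d) % d  ≡⟨ cong (λ x → (x + n % d) % d) (m%n%n≡m%n m d) ⟩
  (m % d + n % d) % d      ≡⟨ %-distribˡ-+ m n d ⟨
  (m + n) % d              ∎
  where open ≡-Reasoning

module _ (m : ℕ) .{{_ : NonZero m}} where

  gap : ℕ → ℕ → ℕ
  gap u w with u <? w
  ... | yes _ = w ∸ u
  ... | no  _ = m + w ∸ u

  gap-positive : ∀ {u} w → u < m → 0 < gap u w
  gap-positive {u} w u<m with u <? w
  ... | yes u<w = m<n⇒0<n∸m u<w
  ... | no  _   = m<n⇒0<n∸m (<-≤-trans u<m (m≤m+n m w))

  gap-≤ : ∀ u {w} → w < m → gap u w ≤ m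
  gap-≤ u {w} w<m with u <? w
  ... | yes _   = ≤-trans (m∸n≤m w u) (<⇒≤ w<m)
  ... | no  u≮w = ≤-trans (∸-monoʳ-≤ (m + w) (≮⇒≥ u≮w)) (≤-reflexive (m+n∸n≡m m w))

  gap-< : ∀ {u w} → u < m → w < m → u ≢ w → gap u w < m
  gap-< {u} {w} u<m w<m u≢w with u <? w
  ... | yes _   = ≤-<-trans (m∸n≤m w u) w<m
  ... | no  u≮w = <-≤-trans (∸-monoʳ-< (≤∧≢⇒< (≮⇒≥ u≮w) (u≢w ∘ sym)) (≤-trans (<⇒≤ u<m) (m≤m+n m w)))
                            (≤-reflexive (m+n∸n≡m m w))

  gap-mod : ∀ {u w} → u < m → w < m → (u + gap u w) % m ≡ w
  gap-mod {u} {w} u<m w<m with u <? w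
  ... | yes u<w = trans (cong (_% m) (m+[n∸m]≡n (<⇒≤ u<w))) (m<n⇒m%n≡m w<m)
  ... | no  _   = begin
    (u + (m + w ∸ u)) % m ≡⟨ cong (_% m) (m+[n∸m]≡n (≤-trans (<⇒≤ u<m) (m≤m+n m w))) ⟩
    (m + w) % m           ≡⟨ cong (_% m) (+-comm m w) ⟩
    (w + m) % m           ≡⟨ [m+n]%n≡m%n w m ⟩
    w % m                 ≡⟨ m<n⇒m%n≡m w<m ⟩
    w                     ∎
    where open ≡-Reasoning

  offset : ∀ {r} → (Fin (suc r) → ℕ) → Fin (suc r) → ℕ
  offset         ℓ zero    = 0
  offset {suc r} ℓ (suc i) = gap (ℓ zero) (ℓ (suc zero)) + offset (ℓ ∘ suc) i

  offset-strict : ∀ {r} (ℓ : Fin (suc r) → ℕ) → (∀ i → ℓ i < m) →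
                  ∀ {i j} → i <ᶠ j → offset ℓ i < offset ℓ j
  offset-strict {suc r} ℓ ℓ<m {zero}  {suc j} _ =
    <-≤-trans (gap-positive (ℓ (suc zero)) (ℓ<m zero)) (m≤m+n _ _)
  offset-strict {suc r} ℓ ℓ<m {suc i} {suc j} (s≤s i<j) =
    +-monoʳ-< (gap (ℓ zero) (ℓ (suc zero))) (offset-strict (ℓ ∘ suc) (ℓ<m ∘ suc) i<j)

  offset-mono : ∀ {r} (ℓ : Fin (suc r) → ℕ) {i j} → i ≤ᶠ j → offset ℓ i ≤ offset ℓ j
  offset-mono         ℓ {zero}  _         = z≤n
  offset-mono {suc r} ℓ {suc i} {suc j} (s≤s i≤j) =
    +-monoʳ-≤ (gap (ℓ zero) (ℓ (suc zero))) (offset-mono (ℓ ∘ suc) i≤j)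

  offset-≤ : ∀ {r} (ℓ : Fin (suc r) → ℕ) → (∀ i → ℓ i < m) → ∀ i → offset ℓ i ≤ toℕ i * m
  offset-≤         ℓ ℓ<m zero    = z≤n
  offset-≤ {suc r} ℓ ℓ<m (suc i) =
    +-mono-≤ (gap-≤ (ℓ zero) (ℓ<m (suc zero))) (offset-≤ (ℓ ∘ suc) (ℓ<m ∘ suc) i)

  offset-mod : ∀ {r} (ℓ : Fin (suc r) → ℕ) → (∀ i → ℓ i < m) → ∀ i → (ℓ zero + offset ℓ i) % m ≡ ℓ i
  offset-mod         ℓ ℓ<m zero    = trans (cong (_% m) (+-identityʳ (ℓ zero))) (m<n⇒m%n≡m (ℓ<m zero))
  offset-mod {suc r} ℓ ℓ<m (suc i) = begin
    (ℓ₀ + (d + offset (ℓ ∘ suc) i)) % m     ≡⟨ cong (_% m) (+-assoc ℓ₀ d _) ⟨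
    (ℓ₀ + d + offset (ℓ ∘ suc) i) % m       ≡⟨ [m%d+n]%d≡[m+n]%d (ℓ₀ + d) _ m ⟨
    ((ℓ₀ + d) % m + offset (ℓ ∘ suc) i) % m ≡⟨ cong (λ x → (x + offset (ℓ ∘ suc) i) % m) (gap-mod (ℓ<m zero) (ℓ<m (suc zero))) ⟩
    (ℓ₁ + offset (ℓ ∘ suc) i) % m           ≡⟨ offset-mod (ℓ ∘ suc) (ℓ<m ∘ suc) i ⟩
    ℓ (suc i)                               ∎
    where
    open ≡-Reasoning
    ℓ₀ ℓ₁ d : ℕ
    ℓ₀ = ℓ zero
    ℓ₁ = ℓ (suc zero)
    d  = gap ℓ₀ ℓ₁

  offset-last : ∀ {r} (ℓ : Fin (suc r) → ℕ) → (∀ i → ℓ i < m) →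
                offset ℓ (fromℕ r) < r * m ⊎ (∀ i → ℓ i ≡ ℓ zero)
  offset-last {zero}  ℓ ℓ<m = inj₂ λ { zero → refl }
  offset-last {suc r} ℓ ℓ<m with offset-last (ℓ ∘ suc) (ℓ<m ∘ suc)
  ... | inj₁ short = inj₁ (+-mono-≤-< (gap-≤ (ℓ zero) (ℓ<m (suc zero))) short)
  ... | inj₂ constant with ℓ (suc zero) ≟ ℓ zero
  ...   | yes ℓ₁≡ℓ₀ = inj₂ λ { zero → refl ; (suc i) → trans (constant i) ℓ₁≡ℓ₀ }
  ...   | no  ℓ₁≢ℓ₀ = inj₁ (+-mono-<-≤ (gap-< (ℓ<m zero) (ℓ<m (suc zero)) (ℓ₁≢ℓ₀ ∘ sym))
                                      (subst (λ t → offset (ℓ ∘ suc) (fromℕ r) ≤ t * m) (toℕ-fromℕ r)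
                                             (offset-≤ (ℓ ∘ suc) (ℓ<m ∘ suc) (fromℕ r))))

increasing⇒injective : ∀ {k n} {f : Fin k → Fin n} → (∀ {i j} → i <ᶠ j → f i <ᶠ f j) → Injective _≡_ _≡_ f
increasing⇒injective f-< {i} {j} fi≡fj with Finₚ.<-cmp i j
... | tri< i<j _ _ = contradiction fi≡fj (Finₚ.<⇒≢ (f-< i<j))
... | tri≈ _ i≡j _ = i≡j
... | tri> _ _ j<i = contradiction (sym fi≡fj) (Finₚ.<⇒≢ (f-< j<i))

module _ {n : ℕ} where

  transpose-matchˡ : ∀ (i j : Fin n) → transpose i j i ≡ j
  transpose-matchˡ i j with i ≟ᶠ i
  ... | yes _   = refl
  ... | no  i≢i = contradiction refl i≢i

  transpose-fix : ∀ {i j k : Fin n} → k ≢ i → k ≢ j → transpose i j k ≡ k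
  transpose-fix {i} {j} {k} k≢i k≢j with k ≟ᶠ i
  ... | yes k≡i = contradiction k≡i k≢i
  ... | no  _ with k ≟ᶠ j
  ...   | yes k≡j = contradiction k≡j k≢j
  ...   | no  _   = refl

  transpose-injective : ∀ (i j : Fin n) → Injective _≡_ _≡_ (transpose i j)
  transpose-injective i j {k} {k′} eq = begin
    k                               ≡⟨ transpose-inverse j i ⟨
    transpose j i (transpose i j k)  ≡⟨ cong (transpose j i) eq ⟩
    transpose j i (transpose i j k′) ≡⟨ transpose-inverse j i ⟩
    k′                              ∎
    where open ≡-Reasoning

  transpose-preserves : ∀ {A : Set} (f : Fin n → A) {i j} → f i ≡ f j → ∀ k → f (transpose i j k) ≡ f k
  transpose-preserves f {i} {j} fi≡fj k with k ≟ᶠ i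
  ... | yes refl = sym fi≡fj
  ... | no  _ with k ≟ᶠ j
  ...   | yes refl = fi≡fj
  ...   | no  _    = refl

rearrange : ∀ {n r} {A : Set} (colour : Fin n → A) (c₀ : Fin n → Fin n) (p w : Fin r → Fin n) →
            Injective _≡_ _≡_ c₀ → Injective _≡_ _≡_ p → Injective _≡_ _≡_ w →
            (∀ i → colour (w i) ≡ colour (c₀ (p i))) →
            ∃[ c ] Injective _≡_ _≡_ c × colour ∘ c ≗ colour ∘ c₀ × (∀ i → c (p i) ≡ w i)
rearrange {r = zero}  colour c₀ p w c₀-inj p-inj w-inj same-colour =
  c₀ , c₀-inj , (λ _ → refl) , λ ()
rearrange {r = suc r} colour c₀ p w c₀-inj p-inj w-inj same-colour
  with rearrange colour c₀ (p ∘ suc) (w ∘ suc) c₀-inj (suc-injective ∘ p-inj) (suc-injective ∘ w-inj) (same-colour ∘ suc)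
... | c′ , c′-inj , c′-colour , c′-sends =
  transpose x y ∘ c′ , c′-inj ∘ transpose-injective x y , c-colour , c-sends
  where
  x y : Fin _
  x = c′ (p zero)
  y = w zero

  c-colour : colour ∘ transpose x y ∘ c′ ≗ colour ∘ c₀
  c-colour s = trans (transpose-preserves colour (trans (c′-colour (p zero)) (sym (same-colour zero))) (c′ s))
                     (c′-colour s)

  c-sends : ∀ i → transpose x y (c′ (p i)) ≡ w i
  c-sends zero    = transpose-matchˡ x y
  c-sends (suc i) = trans (cong (transpose x y) (c′-sends i)) (transpose-fix w₁≢x w₁≢y)
    where
    w₁≢x : w (suc i) ≢ x
    w₁≢x eq = 0≢1+n (sym (p-inj (c′-inj (trans (c′-sends i) eq))))
    w₁≢y : w (suc i) ≢ y
    w₁≢y eq = 0≢1+n (sym (w-inj eq))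

module _ {n : ℕ} .{{_ : NonZero n}} where

  rotate : ℕ → Fin n → Fin n
  rotate L s = (L + toℕ s) mod n

  toℕ-rotate : ∀ L s → toℕ (rotate L s) ≡ (L + toℕ s) % n
  toℕ-rotate L s = toℕ-fromℕ< (m%n<n (L + toℕ s) n)

  rotate-injective : ∀ {L} → L ≤ n → Injective _≡_ _≡_ (rotate L)
  rotate-injective {L} L≤n {s} {s′} eq = toℕ-injective (begin
    toℕ s                                ≡⟨ unrotate-rotate s ⟨
    ((L + toℕ s) % n + (n ∸ L)) % n      ≡⟨ cong (λ x → (x + (n ∸ L)) % n) same ⟩
    ((L + toℕ s′) % n + (n ∸ L)) % n     ≡⟨ unrotate-rotate s′ ⟩
    toℕ s′                               ∎)
    where
    open ≡-Reasoning
    same : (L + toℕ s) % n ≡ (L + toℕ s′) % n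
    same = trans (sym (toℕ-rotate L s)) (trans (cong toℕ eq) (toℕ-rotate L s′))
    unrotate-rotate : ∀ t → ((L + toℕ t) % n + (n ∸ L)) % n ≡ toℕ t
    unrotate-rotate t = begin
      ((L + toℕ t) % n + (n ∸ L)) % n    ≡⟨ [m%d+n]%d≡[m+n]%d (L + toℕ t) (n ∸ L) n ⟩
      (L + toℕ t + (n ∸ L)) % n          ≡⟨ cong (_% n) (trans (cong (_+ (n ∸ L)) (+-comm L (toℕ t))) (+-assoc (toℕ t) L (n ∸ L))) ⟩
      (toℕ t + (L + (n ∸ L))) % n        ≡⟨ cong (λ x → (toℕ t + x) % n) (m+[n∸m]≡n L≤n) ⟩
      (toℕ t + n) % n                    ≡⟨ [m+n]%n≡m%n (toℕ t) n ⟩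
      toℕ t % n                          ≡⟨ m<n⇒m%n≡m (toℕ<n t) ⟩
      toℕ t                              ∎

module CycleBlowUp (a-1 m-2 : ℕ) where

  a m n : ℕ
  a = suc a-1
  m = 2 + m-2
  n = a * m

  m≤n : m ≤ n
  m≤n = m≤m+n m (a-1 * m)

  layer : Fin n → ℕ
  layer t = toℕ t % m

  next : ℕ → ℕ
  next l = suc l % m

  layer<m : ∀ t → layer t < m
  layer<m t = m%n<n (toℕ t) m

  next<m : ∀ l → next l < m
  next<m l = m%n<n (suc l) m

  -- m ≥ 2 is what excludes loops: layer m − 1 wraps round to layer 0.
  next-≢ : ∀ {l} → l < m → next l ≢ l
  next-≢ {l} l<m with m≤n⇒m<n∨m≡n l<m
  ... | inj₁ 1+l<m = 1+n≢n ∘ trans (sym (m<n⇒m%n≡m 1+l<m))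
  ... | inj₂ refl  = (λ ()) ∘ trans (sym (n%n≡0 m))

  blowUp : Digraph n
  arc     blowUp u v = next (layer u) ≡ᵇ layer v
  noLoops blowUp v   = dec-false (next (layer v) ≟ layer v) (next-≢ (layer<m v))

  count-layer : ∀ h → count n (h ∘ (_% m)) ≡ a * count m h
  count-layer h = begin
    count (a * m) (h ∘ (_% m))  ≡⟨ count-periodic a m (h ∘ (_% m)) (cong h ∘ [m+x]%m≡x%m) ⟩
    a * count m (h ∘ (_% m))    ≡⟨ cong (a *_) (count-cong m (λ x x<m → cong h (m<n⇒m%n≡m x<m))) ⟩
    a * count m h               ∎
    where
    open ≡-Reasoning
    [m+x]%m≡x%m : ∀ x → (m + x) % m ≡ x % m
    [m+x]%m≡x%m x = trans (cong (_% m) (+-comm m x)) ([m+n]%n≡m%n x m)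

  blowUp-diregular : Diregular a blowUp
  blowUp-diregular v = out-degree , in-degree
    where
    open ≡-Reasoning
    out-degree : outDeg blowUp v ≡ a
    out-degree = begin
      outDeg blowUp v                            ≡⟨ length-filterᵇ-allFin n ((next (layer v) ≡ᵇ_) ∘ (_% m)) ⟩
      count n ((next (layer v) ≡ᵇ_) ∘ (_% m))    ≡⟨ count-layer (next (layer v) ≡ᵇ_) ⟩
      a * count m (next (layer v) ≡ᵇ_)           ≡⟨ cong (a *_) (count-≡ᵇ (next (layer v)) (next<m (layer v))) ⟩
      a * 1                                      ≡⟨ *-identityʳ a ⟩
      a                                          ∎
    in-degree : inDeg blowUp v ≡ a
    in-degree = begin
      inDeg blowUp v                             ≡⟨ length-filterᵇ-allFin n ((_≡ᵇ layer v) ∘ next ∘ (_% m)) ⟩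
      count n ((_≡ᵇ layer v) ∘ next ∘ (_% m))    ≡⟨ count-layer ((_≡ᵇ layer v) ∘ next) ⟩
      a * count m ((_≡ᵇ layer v) ∘ next)         ≡⟨ cong (a *_) (count-rotate (suc m-2) (_≡ᵇ layer v)) ⟩
      a * count m (_≡ᵇ layer v)                  ≡⟨ cong (a *_) (count-cong m (λ x _ → ≡ᵇ-comm x (layer v))) ⟩
      a * count m (layer v ≡ᵇ_)                  ≡⟨ cong (a *_) (count-≡ᵇ (layer v) (layer<m v)) ⟩
      a * 1                                      ≡⟨ *-identityʳ a ⟩
      a                                          ∎

  next-% : ∀ x → next (x % m) ≡ next x
  next-% x = begin
    suc (x % m) % m  ≡⟨ cong (_% m) (+-comm 1 (x % m)) ⟩
    (x % m + 1) % m  ≡⟨ [m%d+n]%d≡[m+n]%d x 1 m ⟩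
    (x + 1) % m      ≡⟨ cong (_% m) (+-comm x 1) ⟩
    suc x % m        ∎
    where open ≡-Reasoning

  Layered : ℕ → (Fin n → Fin n) → Set
  Layered L c = ∀ s → layer (c s) ≡ (L + toℕ s) % m

  rotate-layered : ∀ L → Layered L (rotate L)
  rotate-layered L s = trans (cong (_% m) (toℕ-rotate L s)) (m∣n⇒o%n%m≡o%m m n (L + toℕ s) (divides a refl))

  layered-arc : ∀ {L c} → Layered L c → ∀ {s s′} → next (L + toℕ s) ≡ (L + toℕ s′) % m → Arc blowUp (c s) (c s′)
  layered-arc {L} {c} c-layered {s} {s′} step = ≡⇒≡ᵇ _ _ (begin
    next (layer (c s))          ≡⟨ cong next (c-layered s) ⟩
    next ((L + toℕ s) % m)      ≡⟨ next-% (L + toℕ s) ⟩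
    next (L + toℕ s)            ≡⟨ step ⟩
    (L + toℕ s′) % m            ≡⟨ c-layered s′ ⟨
    layer (c s′)                ∎)
    where open ≡-Reasoning

  layered-hamCycle : ∀ {L c} → Injective _≡_ _≡_ c → Layered L c → HamCycle blowUp
  cyc      (layered-hamCycle {c = c} c-inj c-layered) = c
  cycInj   (layered-hamCycle c-inj c-layered) = c-inj
  cycArcs  (layered-hamCycle {L} {c} c-inj c-layered) i =
    layered-arc {L} {c} c-layered (cong (_% m) (trans (cong (λ t → suc (L + t)) (toℕ-inject₁ i)) (sym (+-suc L (toℕ i)))))
  cycClose (layered-hamCycle {L} {c} c-inj c-layered) = layered-arc {L} {c} c-layered (begin
    suc (L + toℕ (fromℕ _)) % m    ≡⟨ cong (λ t → suc (L + t) % m) (toℕ-fromℕ _) ⟩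
    suc (L + _) % m                ≡⟨ cong (_% m) (+-suc L _) ⟨
    (L + a * m) % m                ≡⟨ [m+kn]%n≡m%n L a m ⟩
    L % m                          ≡⟨ cong (_% m) (+-identityʳ L) ⟨
    (L + 0) % m                    ∎)
    where open ≡-Reasoning

  layers-not-constant : ∀ (v : Fin (suc a) → Fin n) → Injective _≡_ _≡_ v → ¬ (∀ i → layer (v i) ≡ layer (v zero))
  layers-not-constant v v-inj constant = <-irrefl refl (injective⇒≤ column-inj)
    where
    column : Fin (suc a) → Fin a
    column i = fromℕ< (m<n*o⇒m/o<n {n = a} (toℕ<n (v i)))
    column-inj : Injective _≡_ _≡_ column
    column-inj {i} {j} eq = v-inj (toℕ-injective (begin
      toℕ (v i)                          ≡⟨ m≡m%n+[m/n]*n (toℕ (v i)) m ⟩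
      layer (v i) + toℕ (v i) / m * m    ≡⟨ cong₂ (λ x y → x + y * m) (trans (constant i) (sym (constant j))) quotients ⟩
      layer (v j) + toℕ (v j) / m * m    ≡⟨ m≡m%n+[m/n]*n (toℕ (v j)) m ⟨
      toℕ (v j)                          ∎))
      where
      open ≡-Reasoning
      quotients : toℕ (v i) / m ≡ toℕ (v j) / m
      quotients = trans (sym (toℕ-fromℕ< _)) (trans (cong toℕ eq) (toℕ-fromℕ< _))

  module Positions (v : Fin (suc a) → Fin n) (v-inj : Injective _≡_ _≡_ v) where
    ℓ : Fin (suc a) → ℕ
    ℓ i = layer (v i)

    ℓ<m : ∀ i → ℓ i < m
    ℓ<m i = layer<m (v i)

    L : ℕ
    L = ℓ zero

    L≤n : L ≤ n
    L≤n = ≤-trans (<⇒≤ (ℓ<m zero)) m≤n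

    P : Fin (suc a) → ℕ
    P = offset m ℓ

    P-last<n : P (fromℕ a) < n
    P-last<n with offset-last m ℓ ℓ<m
    ... | inj₁ short    = short
    ... | inj₂ constant = contradiction constant (layers-not-constant v v-inj)

    p : Fin (suc a) → Fin n
    p i = fromℕ< (≤-<-trans (offset-mono m ℓ (≤fromℕ i)) P-last<n)

    toℕ-p : ∀ i → toℕ (p i) ≡ P i
    toℕ-p i = toℕ-fromℕ< _

    p-increasing : ∀ i j → i <ᶠ j → p i <ᶠ p j
    p-increasing i j i<j = subst₂ _<_ (sym (toℕ-p i)) (sym (toℕ-p j)) (offset-strict m ℓ ℓ<m i<j)

    p-inj : Injective _≡_ _≡_ p
    p-inj = increasing⇒injective (p-increasing _ _)

    same-layer : ∀ i → layer (v i) ≡ layer (rotate L (p i))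
    same-layer i = sym (begin
      layer (rotate L (p i))  ≡⟨ rotate-layered L (p i) ⟩
      (L + toℕ (p i)) % m     ≡⟨ cong (λ t → (L + t) % m) (toℕ-p i) ⟩
      (L + P i) % m           ≡⟨ offset-mod m ℓ ℓ<m i ⟩
      ℓ i                     ∎)
      where open ≡-Reasoning

  blowUp-ordered : OrderedHamiltonian (suc a) blowUp
  blowUp-ordered v v-inj =
    let c , c-inj , c-layer , c-sends = rearrange layer (rotate L) p v (rotate-injective L≤n) p-inj v-inj same-layer
    in  layered-hamCycle {L} {c} c-inj (λ s → trans (c-layer s) (rotate-layered L s)) ,
        c-sends zero , p , c-sends , p-increasing
    where open Positions v v-inj

theorem5p3 : ∀ (k : ℕ) → 2 ≤ k → ∀ (N : ℕ) →
    Σ ℕ λ m → (N ≤ suc m) × Σ (Digraph (suc m)) λ D →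
      Diregular (k ∸ 1) D × OrderedHamiltonian k D
theorem5p3 (suc (suc a-1)) _ N =
  _ , ≤-trans (m≤n+m N 2) m≤n , blowUp , blowUp-diregular , blowUp-ordered
  where open CycleBlowUp a-1 N
theorem5p3 (suc zero) (s≤s ()) N
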